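{- Let $\mathbf x$ be an infinite word over a finite alphabet and $n \ge 2$ an integer with $r(n,\mathbf x) \ge r(n-1,\mathbf x) + 2$. Then $r(n,\mathbf x) \ge 2n+1$.
   Context: With $x_i^j = x_i\cdots x_j$, $r(n,\mathbf x) = \min\{ m \ge 1 : x_i^{i+n-1} = x_{m-n+1}^{m} \text{ for some } i \text{ with } 1 \le i \le m-n\}$. -}

module Defs where

open import Data.Nat using (ℕ; _+_; _∸_; _<_; _≤_; suc)
open import Data.Product using (Σ; _×_)
open import Relation.Binary.PropositionalEquality using (_≡_)

-- An infinite word x = x_1 x_2 x_3 ... over an alphabet A is represented
-- 0-indexed as a function  x : ℕ → A  with  x_i = x (i - 1).

-- The factor x_i^{i+n-1} (1-indexed start i, i.e. 0-indexed start i - 1)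
-- equals the suffix x_{m-n+1}^m of the prefix of length m.
-- Witness: 1-indexed i with 1 ≤ i ≤ m - n; written as 0-indexed i' = i - 1,
-- the condition 1 ≤ i ≤ m - n becomes  i' + n < m.
RepeatAt : {A : Set} → ℕ → (ℕ → A) → ℕ → Set
RepeatAt {A} n x m =
  Σ ℕ (λ i' → (i' + n < m) ×
    ((j : ℕ) → j < n → x (i' + j) ≡ x ((m ∸ n) + j)))

IsR : {A : Set} → ℕ → (ℕ → A) → ℕ → Set
IsR n x m =
  (1 ≤ m) × RepeatAt n x m ×
  ((m' : ℕ) → 1 ≤ m' → RepeatAt n x m' → m ≤ m')

module Submission where

-- Let a = r(n,x) and b = r(n-1,x) with b + 2 ≤ a, and suppose a ≤ 2n.
-- The repeat defining a gives a factor x_i … x_{a-1} of period p ≥ 1 with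
-- i + p + n = a, and a ≤ 2n makes this period short: i + p ≤ n.  The repeat
-- defining b gives a factor x_j … x_{b-1} of period q ≥ 1 with
-- j + q + (n-1) = b.  From position max(i,j) on, the word has period p up to
-- x_b (because b < a) and period q up to x_{b-1}; as i + p ≤ n this common
-- factor has length at least p + q, so the one-step Fine–Wilf lemma
-- `extend` shows x_{b-q} = x_b.  Hence period q reaches x_b, so the last n
-- letters of the prefix of length b + 1 occur earlier, i.e. r(n,x) ≤ b + 1.

open import Defs
open import Data.Nat using (ℕ; _+_; _∸_; _≤_; _*_)
open import Data.Nat using (suc; _<_; _⊔_; s≤s; z≤n; compare; less; equal; greater)
open import Data.Fin using (Fin)
open import Data.Nat.Properties
open import Data.Nat.Induction using (<-wellFounded)
open import Induction.WellFounded using (Acc; acc)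
open import Data.Product using (_,_; _×_; ∃₂)
open import Data.Sum using (inj₁; inj₂)
open import Relation.Binary.PropositionalEquality
open import Algebra.Properties.CommutativeSemigroup +-commutativeSemigroup
  using (xy∙z≈xz∙y)

twice : ∀ n → 2 * n ≡ n + n
twice n = cong (n +_) (+-identityʳ n)

shorten : ∀ {p lo t} → 1 ≤ p → lo + p ≤ suc t → lo ≤ t
shorten {lo = lo} 1≤p lo+p≤1+t = ≤-pred (<-≤-trans (m<m+n lo 1≤p) lo+p≤1+t)

Period : {A : Set} → (ℕ → A) → ℕ → ℕ → ℕ → Set
Period x p lo hi = ∀ s → lo ≤ s → s + p < hi → x s ≡ x (s + p)

module _ {A : Set} (x : ℕ → A) where

  open ≡-Reasoning

  restrict : ∀ {p lo lo′ hi hi′} → lo ≤ lo′ → hi′ ≤ hi →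
    Period x p lo hi → Period x p lo′ hi′
  restrict lo≤lo′ hi′≤hi per s lo′≤s s+p<hi′ =
    per s (≤-trans lo≤lo′ lo′≤s) (<-≤-trans s+p<hi′ hi′≤hi)

  snoc : ∀ {q lo t hi} → Period x q lo hi → t + q ≡ hi → x t ≡ x (t + q) →
    Period x q lo (suc hi)
  snoc {q} {t = t} per t+q≡hi new s lo≤s s+q<1+hi
    with m≤n⇒m<n∨m≡n (≤-pred s+q<1+hi)
  ... | inj₁ s+q<hi = per s lo≤s s+q<hi
  ... | inj₂ s+q≡hi =
    subst (λ u → x u ≡ x (u + q)) (+-cancelʳ-≡ q t s (trans t+q≡hi (sym s+q≡hi))) new

  -- If x_lo … has periods q and p = q + r (the latter up to hi₂, the former
  -- far enough), then from lo + q on it has period r: x_{u+q} = x_u = x_{u+p}.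
  difference : ∀ {q r p lo hi₁ hi₂} → q + r ≡ p → hi₂ ≤ r + hi₁ →
    Period x q lo hi₁ → Period x p lo hi₂ → Period x r (lo + q) hi₂
  difference {q} {r} {lo = lo} {hi₁} {hi₂} refl hi₂≤r+hi₁ perQ perP s lo+q≤s s+r<hi₂
    with m≤n⇒∃[o]m+o≡n lo+q≤s
  ... | o , refl = begin
    x (lo + q + o)        ≡⟨ cong x u+q≡s ⟨
    x (lo + o + q)        ≡⟨ perQ (lo + o) (m≤m+n lo o) u+q<hi₁ ⟨
    x (lo + o)            ≡⟨ perP (lo + o) (m≤m+n lo o) (subst (_< hi₂) (sym u+p≡s+r) s+r<hi₂) ⟩
    x (lo + o + (q + r))  ≡⟨ cong x u+p≡s+r ⟩
    x (lo + q + o + r)    ∎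
    where
    u+q≡s : lo + o + q ≡ lo + q + o
    u+q≡s = xy∙z≈xz∙y lo o q

    u+p≡s+r : lo + o + (q + r) ≡ lo + q + o + r
    u+p≡s+r = trans (sym (+-assoc (lo + o) q r)) (cong (_+ r) u+q≡s)

    u+q<hi₁ : lo + o + q < hi₁
    u+q<hi₁ = subst (_< hi₁) (sym u+q≡s)
      (+-cancelʳ-< r (lo + q + o) hi₁
        (<-≤-trans s+r<hi₂ (≤-trans hi₂≤r+hi₁ (≤-reflexive (+-comm r hi₁)))))

  -- Induction on p + q as in Euclid's algorithm: the larger period is replaced
  -- by the difference of the two, and lo moves right by the smaller one.
  extendAt : ∀ {p q lo t} → Acc _<_ (p + q) → 1 ≤ p → 1 ≤ q → lo + p ≤ suc t →
    Period x p lo (suc (t + q)) → Period x q lo (t + q) → x t ≡ x (t + q)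
  extendAt {p} {q} {lo} {t} (acc smaller) 1≤p 1≤q lo+p≤1+t perP perQ with compare p q
  ... | equal .p = perP t (shorten 1≤p lo+p≤1+t) (n<1+n (t + p))
  ... | less .p k = begin
    x t                  ≡⟨ perP t (shorten 1≤p lo+p≤1+t) (s≤s (+-monoʳ-≤ t (m≤n⇒m≤1+n (m≤m+n p k)))) ⟩
    x (t + p)            ≡⟨ extendAt (smaller (+-monoʳ-< p r<q)) 1≤p (s≤s z≤n)
                              (+-monoˡ-≤ p lo+p≤1+t) perP′ perR ⟩
    x (t + p + suc k)    ≡⟨ cong x t+p+r≡t+q ⟩
    x (t + suc (p + k))  ∎
    where
    r<q : suc k < suc (p + k)
    r<q = s≤s (+-monoˡ-≤ k 1≤p)

    t+p+r≡t+q : t + p + suc k ≡ t + suc (p + k)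
    t+p+r≡t+q = trans (+-assoc t p (suc k)) (cong (t +_) (+-suc p k))

    perP′ : Period x p (lo + p) (suc (t + p + suc k))
    perP′ = restrict (m≤m+n lo p) (≤-reflexive (cong suc t+p+r≡t+q)) perP

    perR : Period x (suc k) (lo + p) (t + p + suc k)
    perR = restrict ≤-refl (≤-reflexive t+p+r≡t+q)
      (difference (+-suc p k) (≤-trans (n≤1+n _) (m≤n+m _ (suc k))) perP perQ)
  ... | greater .q k =
    extendAt (smaller (+-monoˡ-< q (s≤s (+-monoˡ-≤ k 1≤q)))) (s≤s z≤n) 1≤q
      (≤-trans (≤-reflexive lo+q+r≡lo+p) lo+p≤1+t)
      (difference (+-suc q k) (s≤s (m≤n+m (t + q) k)) perQ perP)
      (restrict (m≤m+n lo q) ≤-refl perQ)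
    where
    lo+q+r≡lo+p : lo + q + suc k ≡ lo + suc (q + k)
    lo+q+r≡lo+p = trans (+-assoc lo q (suc k)) (cong (lo +_) (+-suc q k))

  extend : ∀ {p q lo t} → 1 ≤ p → 1 ≤ q → lo + p ≤ suc t →
    Period x p lo (suc (t + q)) → Period x q lo (t + q) → x t ≡ x (t + q)
  extend = extendAt (<-wellFounded _)

  repeat⇒period : ∀ {n m} → RepeatAt n x m →
    ∃₂ λ i p → 1 ≤ p × i + p + n ≡ m × Period x p i m
  repeat⇒period {n} (i , i+n<m , same) with m≤n⇒∃[o]m+o≡n i+n<m
  ... | d , refl = i , suc d , s≤s z≤n , length , period
    where
    length : i + suc d + n ≡ suc (i + n) + d
    length = trans (cong (_+ n) (+-suc i d)) (cong suc (xy∙z≈xz∙y i d n))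

    copyStart : suc (i + n) + d ∸ n ≡ i + suc d
    copyStart = trans (cong (_∸ n) (sym length)) (m+n∸n≡m (i + suc d) n)

    period : Period x (suc d) i (suc (i + n) + d)
    period s i≤s s+p<m with m≤n⇒∃[o]m+o≡n i≤s
    ... | t , refl = begin
      x (i + t)            ≡⟨ same t t<n ⟩
      x (suc (i + n) + d ∸ n + t) ≡⟨ cong (λ e → x (e + t)) copyStart ⟩
      x (i + suc d + t)    ≡⟨ cong x (xy∙z≈xz∙y i (suc d) t) ⟩
      x (i + t + suc d)    ∎
      where
      t<n : t < n
      t<n = +-cancelˡ-< (i + suc d) t n
        (subst₂ _<_ (xy∙z≈xz∙y i t (suc d)) (sym length) s+p<m)

  period⇒repeat : ∀ {n m i p} → 1 ≤ p → i + p + n ≡ m → Period x p i m → RepeatAt n x m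
  period⇒repeat {n} {i = i} {p} 1≤p refl per = i , +-monoˡ-< n (m<m+n i 1≤p) , same
    where
    same : ∀ t → t < n → x (i + t) ≡ x (i + p + n ∸ n + t)
    same t t<n = begin
      x (i + t)          ≡⟨ per (i + t) (m≤m+n i t)
                              (subst (_< i + p + n) (sym (xy∙z≈xz∙y i t p)) (+-monoʳ-< (i + p) t<n)) ⟩
      x (i + t + p)      ≡⟨ cong x (xy∙z≈xz∙y i t p) ⟩
      x (i + p + t)      ≡⟨ cong (λ e → x (e + t)) (m+n∸n≡m (i + p) n) ⟨
      x (i + p + n ∸ n + t) ∎

  extendRepeat : ∀ {n a b} → RepeatAt (suc n) x a → RepeatAt n x b → b < a →
    a ≤ 2 * suc n → RepeatAt (suc n) x (suc b)
  extendRepeat {n} {a} repA repB b<a a≤2n with repeat⇒period repA | repeat⇒period repB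
  ... | i , p , 1≤p , i+p+n≡a , perA | j , q , 1≤q , refl , perB =
    period⇒repeat 1≤q (+-suc (j + q) n) (snoc perB t+q≡b lastLetter)
    where
    t+q≡b : j + n + q ≡ j + q + n
    t+q≡b = xy∙z≈xz∙y j n q

    i+p≤n : i + p ≤ suc n
    i+p≤n = +-cancelʳ-≤ (suc n) (i + p) (suc n)
      (≤-trans (≤-reflexive i+p+n≡a) (≤-trans a≤2n (≤-reflexive (twice (suc n)))))

    lo+p≤1+t : (i ⊔ j) + p ≤ suc (j + n)
    lo+p≤1+t = ≤-trans (≤-reflexive (+-distribʳ-⊔ p i j)) (⊔-lub
      (≤-trans i+p≤n (s≤s (m≤n+m n j)))
      (≤-trans (+-monoʳ-≤ j (≤-trans (m≤n+m p i) i+p≤n)) (≤-reflexive (+-suc j n))))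

    lastLetter : x (j + n) ≡ x (j + n + q)
    lastLetter = extend 1≤p 1≤q lo+p≤1+t
      (restrict (m≤m⊔n i j) (≤-trans (≤-reflexive (cong suc t+q≡b)) b<a) perA)
      (restrict (m≤n⊔m i j) (≤-reflexive t+q≡b) perB)

lemma5p4 : (k : ℕ) (x : ℕ → Fin k) (n : ℕ) → 2 ≤ n →
    (a b : ℕ) → IsR n x a → IsR (n ∸ 1) x b →
    b + 2 ≤ a → 2 * n + 1 ≤ a
lemma5p4 k x (suc n) (s≤s _) a b (_ , repA , minimal) (_ , repB , _) b+2≤a =
  ≮⇒≥ λ a<2n+1 → <⇒≱ b+1<a (minimal (suc b) (s≤s z≤n) (repeatAtb+1 (a≤2n a<2n+1)))
  where
  a≤2n : a < 2 * suc n + 1 → a ≤ 2 * suc n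
  a≤2n a<2n+1 = +-cancelʳ-≤ 1 a (2 * suc n) (≤-trans (≤-reflexive (+-comm a 1)) a<2n+1)

  b+1<a : suc b < a
  b+1<a = ≤-trans (≤-reflexive (+-comm 2 b)) b+2≤a

  repeatAtb+1 : a ≤ 2 * suc n → RepeatAt (suc n) x (suc b)
  repeatAtb+1 = extendRepeat x repA repB (<⇒≤ b+1<a)
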